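{- Let $X$ be a non-empty subset of a group $G$. If $gX\subsetneq X$ for some $g\in G$, then $(X,Y)$ is not a co-minimal pair for any non-empty subset $Y\subseteq G$. If $Xg\subsetneq X$ for some $g\in G$, then $(Y,X)$ is not a co-minimal pair for any non-empty subset $Y\subseteq G$. Consequently, for an element $x\in G$, the set $\{x,x^2,x^3,\dots\}$ is part of a co-minimal pair in $G$ if and only if $x$ has finite order.
   Context: For non-empty subsets $A,B$ of a group $(G,\cdot)$, $(A,B)$ is a co-minimal pair if $A\cdot B=G$, $(A\setminus\{a\})\cdot B\neq G$ for all $a\in A$, and $A\cdot(B\setminus\{b\})\neq G$ for all $b\in B$. A set $X$ is part of a co-minimal pair if $(X,Y)$ or $(Y,X)$ is a co-minimal pair for some $Y\subseteq G$. -}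

module Defs where

open import Level using (Level; _⊔_; Lift; lift) renaming (suc to lsuc)
open import Algebra.Bundles using (Group)
open import Data.Nat using (ℕ; zero; suc)
open import Data.Product using (Σ; ∃; _×_; _,_; proj₁; proj₂)
open import Data.Sum using (_⊎_)
open import Relation.Nullary using (¬_)
open import Relation.Binary.Core using (Rel)
open import Relation.Binary.Structures using (IsEquivalence)

-- Choice principle of the (ZFC) metatheory, specialised to a group carrier:
-- every equivalence relation on G that is coarser than the group's equality
-- admits a system of representatives r (r x ~ x, and r is constant, up to ≈,
-- on each class).  Needed classically for coset transversals.
RepresentativeChoice : ∀ {c ℓ} → Group c ℓ → Set (lsuc (c ⊔ ℓ))
RepresentativeChoice {c} {ℓ} G =
  (_~_ : Rel Carrier (c ⊔ ℓ)) → IsEquivalence _~_ →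
  (∀ {x y} → x ≈ y → x ~ y) →
  Σ (Carrier → Carrier) λ r → (∀ x → r x ~ x) × (∀ {x y} → x ~ y → r x ≈ r y)
  where open Group G

module GroupDefs {c ℓ} (G : Group c ℓ) where
  open Group G

  record Subset : Set (lsuc (c ⊔ ℓ)) where
    field
      _∋_  : Carrier → Set (c ⊔ ℓ)
      resp : ∀ {x y} → x ≈ y → _∋_ x → _∋_ y
  open Subset public

  NonEmpty : Subset → Set (c ⊔ ℓ)
  NonEmpty A = ∃ λ a → A ∋ a

  _⊆_ : Subset → Subset → Set (c ⊔ ℓ)
  A ⊆ B = ∀ x → A ∋ x → B ∋ x

  _⊊_ : Subset → Subset → Set (c ⊔ ℓ)
  A ⊊ B = A ⊆ B × ∃ λ x → B ∋ x × ¬ (A ∋ x)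

  remove : Subset → Carrier → Subset
  remove A a = record
    { _∋_  = λ x → A ∋ x × ¬ (x ≈ a)
    ; resp = λ x≈y p → resp A x≈y (proj₁ p) , λ y≈a → proj₂ p (trans x≈y y≈a) }

  _·_ : Subset → Subset → Subset
  A · B = record
    { _∋_  = λ z → ∃ λ a → ∃ λ b → A ∋ a × B ∋ b × (a ∙ b) ≈ z
    ; resp = λ x≈y p → let (a , b , pa , pb , e) = p in a , b , pa , pb , trans e x≈y }

  _◁_ : Carrier → Subset → Subset
  g ◁ A = record
    { _∋_  = λ z → ∃ λ a → A ∋ a × (g ∙ a) ≈ z
    ; resp = λ x≈y p → let (a , pa , e) = p in a , pa , trans e x≈y }

  _▷_ : Subset → Carrier → Subset
  A ▷ g = record
    { _∋_  = λ z → ∃ λ a → A ∋ a × (a ∙ g) ≈ z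
    ; resp = λ x≈y p → let (a , pa , e) = p in a , pa , trans e x≈y }

  IsWhole : Subset → Set (c ⊔ ℓ)
  IsWhole A = ∀ g → A ∋ g

  CoMinimal : Subset → Subset → Set (c ⊔ ℓ)
  CoMinimal A B =
    NonEmpty A × NonEmpty B × IsWhole (A · B) ×
    (∀ a → A ∋ a → ¬ IsWhole (remove A a · B)) ×
    (∀ b → B ∋ b → ¬ IsWhole (A · remove B b))

  PartOfCoMinimal : Subset → Set (lsuc (c ⊔ ℓ))
  PartOfCoMinimal X = ∃ λ Y → CoMinimal X Y ⊎ CoMinimal Y X

  pow : Carrier → ℕ → Carrier
  pow x zero    = ε
  pow x (suc n) = x ∙ pow x n

  PositivePowers : Carrier → Subset
  PositivePowers x = record
    { _∋_  = λ y → Lift (c ⊔ ℓ) (∃ λ n → pow x (suc n) ≈ y)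
    ; resp = λ x≈y p → let (lift (n , e)) = p in lift (n , trans e x≈y) }

  FiniteOrder : Carrier → Set ℓ
  FiniteOrder x = ∃ λ n → pow x (suc n) ≈ ε

-- If gX ⊊ X, pick x₀ ∈ X ∖ gX. From G = X·Y we get G = g(X·Y) = (gX)·Y ⊆ (X ∖ {x₀})·Y,
-- so x₀ is redundant and (X, Y) is not co-minimal; the right-handed case is symmetric.
-- When x has infinite order, x·P ⊊ P and P·x ⊊ P for P = {x, x², …}, since x = x·xⁿ⁺¹
-- would give xⁿ⁺¹ = 1. When x has finite order, P is the cyclic subgroup ⟨x⟩, and a subgroup
-- H together with a transversal T of its right cosets is co-minimal: every element of G is
-- uniquely a product ht, so no factor can be dropped.
module Submission where

open import Defs
open import Level using (_⊔_; Lift; lift; lower)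
open import Algebra.Bundles using (Group)
open import Data.Product using (∃; _×_; _,_)
open import Data.Sum using (inj₁; inj₂)
open import Data.Nat using (ℕ; zero; suc; _+_; _*_)
open import Data.Nat.Properties using (*-suc; +-comm)
open import Function using (_∘_)
open import Function.Bundles using (_⇔_; mk⇔)
open import Relation.Nullary using (¬_)
open import Relation.Binary.Core using (Rel)
open import Relation.Binary.Structures using (IsEquivalence)
open import Relation.Binary.PropositionalEquality as ≡ using (_≡_; cong)
open import Axiom.ExcludedMiddle using (ExcludedMiddle)
open import Axiom.DoubleNegationElimination using (em⇒dne)
import Algebra.Properties.Group as GroupProperties
import Algebra.Properties.Monoid.Mult as MonoidMult
import Relation.Binary.Reasoning.Setoid as SetoidReasoning

module CoMinimalPairs {c ℓ} (G : Group c ℓ) where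
  open Group G
  open GroupDefs G
  open GroupProperties G
    using (\\-leftDividesˡ; \\-leftDividesʳ; //-rightDividesˡ; inverseˡ-unique;
           identityʳ-unique; identityˡ-unique; ∙-cancelʳ)
  open SetoidReasoning setoid

  ⊊⇒⊆-remove : ∀ A B → A ⊊ B → ∃ λ b → B ∋ b × A ⊆ remove B b
  ⊊⇒⊆-remove A _ (A⊆B , b , b∈B , b∉A) =
    b , b∈B , λ a a∈A → A⊆B a a∈A , λ a≈b → b∉A (resp A a≈b a∈A)

  isWhole-·-monoˡ : ∀ {A A′ B} → A ⊆ A′ → IsWhole (A · B) → IsWhole (A′ · B)
  isWhole-·-monoˡ A⊆A′ whole g =
    let (a , b , a∈A , b∈B , ab≈g) = whole g in a , b , A⊆A′ a a∈A , b∈B , ab≈g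

  isWhole-·-monoʳ : ∀ {A B B′} → B ⊆ B′ → IsWhole (A · B) → IsWhole (A · B′)
  isWhole-·-monoʳ B⊆B′ whole g =
    let (a , b , a∈A , b∈B , ab≈g) = whole g in a , b , a∈A , B⊆B′ b b∈B , ab≈g

  isWhole-◁· : ∀ {A B} g → IsWhole (A · B) → IsWhole ((g ◁ A) · B)
  isWhole-◁· g whole h =
    let (a , b , a∈A , b∈B , ab≈g\\h) = whole (g \\ h)
    in g ∙ a , b , (a , a∈A , refl) , b∈B , (begin
         g ∙ a ∙ b    ≈⟨ assoc g a b ⟩
         g ∙ (a ∙ b)  ≈⟨ ∙-congˡ ab≈g\\h ⟩
         g ∙ (g \\ h) ≈⟨ \\-leftDividesˡ g h ⟩
         h            ∎)

  isWhole-·▷ : ∀ {A B} g → IsWhole (A · B) → IsWhole (A · (B ▷ g))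
  isWhole-·▷ g whole h =
    let (a , b , a∈A , b∈B , ab≈h//g) = whole (h // g)
    in a , b ∙ g , a∈A , (b , b∈B , refl) , (begin
         a ∙ (b ∙ g)  ≈⟨ assoc a b g ⟨
         a ∙ b ∙ g    ≈⟨ ∙-congʳ ab≈h//g ⟩
         (h // g) ∙ g ≈⟨ //-rightDividesˡ g h ⟩
         h            ∎)

  ◁⊊⇒¬coMinimal : ∀ X g → (g ◁ X) ⊊ X → ∀ Y → ¬ CoMinimal X Y
  ◁⊊⇒¬coMinimal X g gX⊊X Y (_ , _ , whole , minimalˡ , _) =
    let (x₀ , x₀∈X , gX⊆X∖x₀) = ⊊⇒⊆-remove (g ◁ X) X gX⊊X
    in minimalˡ x₀ x₀∈X
         (isWhole-·-monoˡ {g ◁ X} {remove X x₀} {Y} gX⊆X∖x₀ (isWhole-◁· {X} {Y} g whole))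

  ▷⊊⇒¬coMinimal : ∀ X g → (X ▷ g) ⊊ X → ∀ Y → ¬ CoMinimal Y X
  ▷⊊⇒¬coMinimal X g Xg⊊X Y (_ , _ , whole , _ , minimalʳ) =
    let (x₀ , x₀∈X , Xg⊆X∖x₀) = ⊊⇒⊆-remove (X ▷ g) X Xg⊊X
    in minimalʳ x₀ x₀∈X
         (isWhole-·-monoʳ {Y} {X ▷ g} {remove X x₀} Xg⊆X∖x₀ (isWhole-·▷ {Y} {X} g whole))

  record IsSubgroup (H : Subset) : Set (c ⊔ ℓ) where
    field
      ε-closed  : H ∋ ε
      ∙-closed  : ∀ {a b} → H ∋ a → H ∋ b → H ∋ (a ∙ b)
      ⁻¹-closed : ∀ {a} → H ∋ a → H ∋ (a ⁻¹)

  module RightCosets {H : Subset} (isSubgroup : IsSubgroup H) where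
    open IsSubgroup isSubgroup

    _∼_ : Rel Carrier (c ⊔ ℓ)
    a ∼ b = ∃ λ h → H ∋ h × h ∙ a ≈ b

    ≈⇒∼ : ∀ {a b} → a ≈ b → a ∼ b
    ≈⇒∼ {a} a≈b = ε , ε-closed , trans (identityˡ a) a≈b

    ∼-sym : ∀ {a b} → a ∼ b → b ∼ a
    ∼-sym {a} {b} (h , h∈H , ha≈b) = h ⁻¹ , ⁻¹-closed h∈H , (begin
      h \\ b        ≈⟨ ∙-congˡ ha≈b ⟨
      h \\ (h ∙ a)  ≈⟨ \\-leftDividesʳ h a ⟩
      a             ∎)

    ∼-trans : ∀ {a b d} → a ∼ b → b ∼ d → a ∼ d
    ∼-trans {a} {b} {d} (h , h∈H , ha≈b) (k , k∈H , kb≈d) = k ∙ h , ∙-closed k∈H h∈H , (begin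
      k ∙ h ∙ a    ≈⟨ assoc k h a ⟩
      k ∙ (h ∙ a)  ≈⟨ ∙-congˡ ha≈b ⟩
      k ∙ b        ≈⟨ kb≈d ⟩
      d            ∎)

    ∼-isEquivalence : IsEquivalence _∼_
    ∼-isEquivalence = record { refl = ≈⇒∼ refl ; sym = ∼-sym ; trans = ∼-trans }

    module Transversal (rep : Carrier → Carrier) (rep∼ : ∀ a → rep a ∼ a)
                       (rep-cong : ∀ {a b} → a ∼ b → rep a ≈ rep b) where

      transversal : Subset
      transversal = record
        { _∋_  = λ t → Lift (c ⊔ ℓ) (rep t ≈ t)
        ; resp = λ t≈t′ (lift rep-t≈t) →
            lift (trans (rep-cong (≈⇒∼ (sym t≈t′))) (trans rep-t≈t t≈t′)) }

      rep∈transversal : ∀ a → transversal ∋ rep a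
      rep∈transversal a = lift (rep-cong (rep∼ a))

      ∼⇒≈ : ∀ {t t′} → transversal ∋ t → transversal ∋ t′ → t ∼ t′ → t ≈ t′
      ∼⇒≈ (lift rep-t≈t) (lift rep-t′≈t′) t∼t′ =
        trans (sym rep-t≈t) (trans (rep-cong t∼t′) rep-t′≈t′)

      factorisation-unique : ∀ {h h′ t t′} → H ∋ h → H ∋ h′ →
                             transversal ∋ t → transversal ∋ t′ →
                             h ∙ t ≈ h′ ∙ t′ → h ≈ h′ × t ≈ t′
      factorisation-unique {h} {h′} {t} {t′} h∈H h′∈H t∈T t′∈T ht≈h′t′ =
        ∙-cancelʳ t h h′ (trans ht≈h′t′ (∙-congˡ (sym t≈t′))) , t≈t′
        where
          t≈t′ : t ≈ t′
          t≈t′ = ∼⇒≈ t∈T t′∈T (h′ \\ h , ∙-closed (⁻¹-closed h′∈H) h∈H , (begin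
            (h′ \\ h) ∙ t    ≈⟨ assoc (h′ ⁻¹) h t ⟩
            h′ \\ (h ∙ t)    ≈⟨ ∙-congˡ ht≈h′t′ ⟩
            h′ \\ (h′ ∙ t′)  ≈⟨ \\-leftDividesʳ h′ t′ ⟩
            t′               ∎))

      subgroup-transversal-coMinimal : CoMinimal H transversal
      subgroup-transversal-coMinimal =
        (ε , ε-closed) , (rep ε , rep∈transversal ε) , whole , minimalˡ , minimalʳ
        where
          whole : IsWhole (H · transversal)
          whole g =
            let (h , h∈H , h-rep-g≈g) = rep∼ g in h , rep g , h∈H , rep∈transversal g , h-rep-g≈g

          minimalˡ : ∀ a → H ∋ a → ¬ IsWhole (remove H a · transversal)
          minimalˡ a a∈H whole′ =
            let (h , t , (h∈H , h≉a) , t∈T , ht≈a-rep-ε) = whole′ (a ∙ rep ε)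
                (h≈a , _) = factorisation-unique h∈H a∈H t∈T (rep∈transversal ε) ht≈a-rep-ε
            in h≉a h≈a

          minimalʳ : ∀ b → transversal ∋ b → ¬ IsWhole (H · remove transversal b)
          minimalʳ b b∈T whole′ =
            let (h , t , h∈H , (t∈T , t≉b) , ht≈b) = whole′ b
                (_ , t≈b) = factorisation-unique h∈H ε-closed t∈T b∈T
                              (trans ht≈b (sym (identityˡ b)))
            in t≉b t≈b

  subgroup-partOfCoMinimal : RepresentativeChoice G → ∀ {H} → IsSubgroup H → PartOfCoMinimal H
  subgroup-partOfCoMinimal choice isSubgroup =
    let open RightCosets isSubgroup
        (rep , rep∼ , rep-cong) = choice _∼_ ∼-isEquivalence ≈⇒∼
        open Transversal rep rep∼ rep-cong
    in transversal , inj₁ subgroup-transversal-coMinimal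

  module Powers (x : Carrier) where
    open MonoidMult monoid using (×-homo-+) renaming (_×_ to _×ᴹ_)

    pow≡× : ∀ n → pow x n ≡ n ×ᴹ x
    pow≡× zero    = ≡.refl
    pow≡× (suc n) = cong (x ∙_) (pow≡× n)

    pow-+ : ∀ m n → pow x (m + n) ≈ pow x m ∙ pow x n
    pow-+ m n rewrite pow≡× (m + n) | pow≡× m | pow≡× n = ×-homo-+ x m n

    pow-sucʳ : ∀ n → pow x (suc n) ≈ pow x n ∙ x
    pow-sucʳ n = begin
      pow x (suc n)      ≡⟨ cong (pow x) (+-comm 1 n) ⟩
      pow x (n + 1)      ≈⟨ pow-+ n 1 ⟩
      pow x n ∙ (x ∙ ε)  ≈⟨ ∙-congˡ (identityʳ x) ⟩
      pow x n ∙ x        ∎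

  module FiniteOrderPowers {x : Carrier} (m : ℕ) (xᵐ⁺¹≈ε : pow x (suc m) ≈ ε) where
    open Powers x

    pow-multipleOfOrder : ∀ n → pow x (n * suc m) ≈ ε
    pow-multipleOfOrder zero    = refl
    pow-multipleOfOrder (suc n) = begin
      pow x (suc m + n * suc m)          ≈⟨ pow-+ (suc m) (n * suc m) ⟩
      pow x (suc m) ∙ pow x (n * suc m)  ≈⟨ ∙-cong xᵐ⁺¹≈ε (pow-multipleOfOrder n) ⟩
      ε ∙ ε                              ≈⟨ identityˡ ε ⟩
      ε                                  ∎

    pow-⁻¹ : ∀ n → pow x n ⁻¹ ≈ pow x (n * m)
    pow-⁻¹ n = sym (inverseˡ-unique (pow x (n * m)) (pow x n) (begin
      pow x (n * m) ∙ pow x n  ≈⟨ pow-+ (n * m) n ⟨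
      pow x (n * m + n)        ≡⟨ cong (pow x) (≡.trans (+-comm (n * m) n) (≡.sym (*-suc n m))) ⟩
      pow x (n * suc m)        ≈⟨ pow-multipleOfOrder n ⟩
      ε                        ∎))

    pow∈positivePowers : ∀ n → PositivePowers x ∋ pow x n
    pow∈positivePowers zero    = lift (m , xᵐ⁺¹≈ε)
    pow∈positivePowers (suc n) = lift (n , refl)

    positivePowers-isSubgroup : IsSubgroup (PositivePowers x)
    positivePowers-isSubgroup = record
      { ε-closed  = pow∈positivePowers zero
      ; ∙-closed  = λ (lift (i , xⁱ⁺¹≈a)) (lift (j , xʲ⁺¹≈b)) →
          resp (PositivePowers x) (trans (pow-+ (suc i) (suc j)) (∙-cong xⁱ⁺¹≈a xʲ⁺¹≈b))
               (pow∈positivePowers (suc i + suc j))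
      ; ⁻¹-closed = λ (lift (i , xⁱ⁺¹≈a)) →
          resp (PositivePowers x) (trans (sym (pow-⁻¹ (suc i))) (⁻¹-cong xⁱ⁺¹≈a))
               (pow∈positivePowers (suc i * m))
      }

  module InfiniteOrderPowers {x : Carrier} (¬finite : ¬ FiniteOrder x) where
    open Powers x

    x∈positivePowers : PositivePowers x ∋ x
    x∈positivePowers = lift (0 , identityʳ x)

    ◁positivePowers⊊positivePowers : (x ◁ PositivePowers x) ⊊ PositivePowers x
    ◁positivePowers⊊positivePowers =
      (λ _ (a , lift (n , xⁿ⁺¹≈a) , xa≈z) → lift (suc n , trans (∙-congˡ xⁿ⁺¹≈a) xa≈z)) ,
      x , x∈positivePowers ,
      λ (a , lift (n , xⁿ⁺¹≈a) , xa≈x) → ¬finite (n , trans xⁿ⁺¹≈a (identityʳ-unique x a xa≈x))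

    positivePowers▷⊊positivePowers : (PositivePowers x ▷ x) ⊊ PositivePowers x
    positivePowers▷⊊positivePowers =
      (λ _ (a , lift (n , xⁿ⁺¹≈a) , ax≈z) →
         lift (suc n , trans (pow-sucʳ (suc n)) (trans (∙-congʳ xⁿ⁺¹≈a) ax≈z))) ,
      x , x∈positivePowers ,
      λ (a , lift (n , xⁿ⁺¹≈a) , ax≈x) → ¬finite (n , trans xⁿ⁺¹≈a (identityˡ-unique a x ax≈x))

  positivePowers-partOfCoMinimal⇔finiteOrder :
    ExcludedMiddle (c ⊔ ℓ) → RepresentativeChoice G →
    ∀ x → PartOfCoMinimal (PositivePowers x) ⇔ FiniteOrder x
  positivePowers-partOfCoMinimal⇔finiteOrder em choice x = mk⇔ to from
    where
      finiteOrder-stable : ¬ ¬ FiniteOrder x → FiniteOrder x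
      finiteOrder-stable ¬¬finite = lower (em⇒dne em (λ ¬finite → ¬¬finite (¬finite ∘ lift {ℓ = c})))

      to : PartOfCoMinimal (PositivePowers x) → FiniteOrder x
      to (Y , inj₁ coMinimal) = finiteOrder-stable λ ¬finite →
        ◁⊊⇒¬coMinimal (PositivePowers x) x
          (InfiniteOrderPowers.◁positivePowers⊊positivePowers ¬finite) Y coMinimal
      to (Y , inj₂ coMinimal) = finiteOrder-stable λ ¬finite →
        ▷⊊⇒¬coMinimal (PositivePowers x) x
          (InfiniteOrderPowers.positivePowers▷⊊positivePowers ¬finite) Y coMinimal

      from : FiniteOrder x → PartOfCoMinimal (PositivePowers x)
      from (m , xᵐ⁺¹≈ε) =
        subgroup-partOfCoMinimal choice (FiniteOrderPowers.positivePowers-isSubgroup m xᵐ⁺¹≈ε)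

lemma3p1 : ∀ {c ℓ} → ExcludedMiddle (c ⊔ ℓ) → (G : Group c ℓ) → RepresentativeChoice G →
    let open Group G using (Carrier)
        open GroupDefs G
    in ((X : Subset) → NonEmpty X → (∃ λ g → (g ◁ X) ⊊ X) →
          (Y : Subset) → NonEmpty Y → ¬ CoMinimal X Y)
       × ((X : Subset) → NonEmpty X → (∃ λ g → (X ▷ g) ⊊ X) →
          (Y : Subset) → NonEmpty Y → ¬ CoMinimal Y X)
       × ((x : Carrier) → PartOfCoMinimal (PositivePowers x) ⇔ FiniteOrder x)
lemma3p1 em G choice =
    (λ X _ (g , gX⊊X) Y _ → ◁⊊⇒¬coMinimal X g gX⊊X Y)
  , (λ X _ (g , Xg⊊X) Y _ → ▷⊊⇒¬coMinimal X g Xg⊊X Y)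
  , positivePowers-partOfCoMinimal⇔finiteOrder em choice
  where open CoMinimalPairs G
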